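{- Let $G$ be a $K_2$-hypohamiltonian graph containing a triangle $uvw$. Then $u$ has at least two neighbours not in $N[v]\cup N[w]$.
   Context: All graphs are finite, simple and connected. A graph is hamiltonian if it has a cycle through all its vertices. $G$ is $K_2$-hamiltonian if $G-x-y$ is hamiltonian for every pair of adjacent vertices $x,y$, and $K_2$-hypohamiltonian if moreover $G$ is not hamiltonian. $N[v]$ denotes the closed neighbourhood of $v$ (the set consisting of $v$ and its neighbours). -}

module Defs where

open import Data.Nat using (ℕ; _≥_)
open import Data.Fin using (Fin)
open import Data.List using (List; length; head; last; [])
open import Data.List.Membership.Propositional using (_∈_)
open import Data.List.Relation.Unary.Unique.Propositional using (Unique)
open import Data.List.Relation.Unary.Linked using (Linked)
open import Data.Maybe using (Maybe; just; nothing)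
open import Data.Product using (Σ; _×_; _,_)
open import Data.Empty using (⊥)
open import Data.Unit using (⊤)
open import Data.Sum using (_⊎_)
open import Relation.Binary.PropositionalEquality using (_≡_)
open import Relation.Nullary using (¬_)
open import Relation.Binary.Construct.Closure.ReflexiveTransitive using (Star)

record Graph (n : ℕ) : Set₁ where
  field
    Adj    : Fin n → Fin n → Set
    sym    : ∀ {x y} → Adj x y → Adj y x
    irrefl : ∀ {x} → ¬ Adj x x
open Graph public

Connected : ∀ {n} → Graph n → Set
Connected G = ∀ x y → Star (Adj G) x y

Closes : ∀ {n} → Graph n → List (Fin n) → Set
Closes G cs with head cs | last cs
... | just a | just b = Adj G b a
... | _      | _      = ⊥

record HamCycleOn {n} (G : Graph n) (Keep : Fin n → Set) (cs : List (Fin n)) : Set where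
  field
    long     : length cs ≥ 3
    distinct : Unique cs
    adjacent : Linked (Adj G) cs
    closes   : Closes G cs
    sound    : ∀ x → x ∈ cs → Keep x
    complete : ∀ x → Keep x → x ∈ cs

Hamiltonian : ∀ {n} → Graph n → Set
Hamiltonian {n} G = Σ (List (Fin n)) (HamCycleOn G (λ _ → ⊤))

HamiltonianMinus : ∀ {n} → Graph n → Fin n → Fin n → Set
HamiltonianMinus {n} G x y =
  Σ (List (Fin n)) (HamCycleOn G (λ z → ¬ z ≡ x × ¬ z ≡ y))

K2-Hamiltonian : ∀ {n} → Graph n → Set
K2-Hamiltonian G = ∀ x y → Adj G x y → HamiltonianMinus G x y

K2-Hypohamiltonian : ∀ {n} → Graph n → Set
K2-Hypohamiltonian G = K2-Hamiltonian G × ¬ Hamiltonian G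

InClosedNbhd : ∀ {n} → Graph n → Fin n → Fin n → Set
InClosedNbhd G v z = z ≡ v ⊎ Adj G v z

-- Let C be a hamiltonian cycle of G - v - w and let a, b be the two
-- neighbours of u on C.  If a were adjacent to w, replacing the edge ua of C
-- by the path u v w a would give a hamiltonian cycle of G; if a were adjacent
-- to v, the path u w v a would.  The same holds for b, so a and b are two
-- neighbours of u outside N[v] ∪ N[w].
module Submission where

open import Defs
open import Data.Nat using (ℕ; _≤_; s≤s; z≤n)
open import Data.Fin using (Fin)
open import Data.Fin.Properties using (_≟_)
open import Data.List using (List; []; _∷_; _++_; [_]; _∷ʳ_; last; initLast; _∷ʳ′_)
open import Data.List.Properties using (++-assoc; ++-identityʳ)
open import Data.List.Membership.Propositional using (_∈_)
open import Data.List.Membership.Propositional.Properties using (∈-∃++; ∈-++⁺ʳ)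
open import Data.List.Relation.Unary.Any using (here; there)
open import Data.List.Relation.Unary.All as All using (All; _∷_)
open import Data.List.Relation.Unary.AllPairs using (_∷_)
open import Data.List.Relation.Unary.Unique.Propositional using (Unique)
open import Data.List.Relation.Unary.Linked as Linked using (Linked; [-]; _∷_)
open import Data.List.Relation.Unary.Linked.Properties using (++⁺)
open import Data.List.Relation.Binary.Permutation.Propositional using (_↭_; ↭-sym; ↭⇒↭ₛ)
open import Data.List.Relation.Binary.Permutation.Propositional.Properties using (↭-length; ∈-resp-↭; ∷↭∷ʳ)
import Data.List.Relation.Binary.Permutation.Setoid.Properties as SetoidPermutation
open import Data.Maybe using (just; nothing)
open import Data.Maybe.Relation.Binary.Connected using (just) renaming (Connected to MaybeConnected)
open import Data.Product using (Σ; _×_; _,_; proj₁; proj₂; swap)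
open import Data.Sum using (_⊎_; inj₁; inj₂)
open import Data.Empty using (⊥-elim)
open import Data.Unit using (tt)
open import Relation.Nullary using (¬_; yes; no)
open import Relation.Unary using (_≐_)
open import Relation.Binary.PropositionalEquality using (_≡_; refl; subst; setoid) renaming (sym to ≡-sym)

Unique-resp-↭ : ∀ {A : Set} {xs ys : List A} → xs ↭ ys → Unique xs → Unique ys
Unique-resp-↭ {A} p = SetoidPermutation.Unique-resp-↭ (setoid A) (↭⇒↭ₛ p)

last-∷ʳ : ∀ {A : Set} (xs : List A) x → last (xs ∷ʳ x) ≡ just x
last-∷ʳ []           x = refl
last-∷ʳ (_ ∷ [])     x = refl
last-∷ʳ (_ ∷ y ∷ xs) x = last-∷ʳ (y ∷ xs) x

module _ {n : ℕ} (G : Graph n) where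

  Avoiding : Fin n → Fin n → Fin n → Set
  Avoiding p q z = ¬ z ≡ p × ¬ z ≡ q

  Adj⇒≢ : ∀ {x y} → Adj G x y → ¬ x ≡ y
  Adj⇒≢ xy refl = irrefl G xy

  closes⇒connected : ∀ x xs → Closes G (x ∷ xs) → MaybeConnected (Adj G) (last (x ∷ xs)) (just x)
  closes⇒connected x xs c with last (x ∷ xs)
  ... | just _  = just c
  ... | nothing = ⊥-elim c

  closing-edge : ∀ x xs y → Closes G (x ∷ xs ∷ʳ y) → Adj G y x
  closing-edge x xs y c rewrite last-∷ʳ (x ∷ xs) y = c

  closes-∷ʳ : ∀ x xs y → Adj G y x → Closes G (x ∷ xs ∷ʳ y)
  closes-∷ʳ x xs y yx rewrite last-∷ʳ (x ∷ xs) y = yx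

  HamCycleOn-resp-↭ : ∀ {Keep cs ds} → cs ↭ ds → Linked (Adj G) ds → Closes G ds →
                      HamCycleOn G Keep cs → HamCycleOn G Keep ds
  HamCycleOn-resp-↭ cs↭ds adjacent closes C = record
    { long     = subst (3 ≤_) (↭-length cs↭ds) (HamCycleOn.long C)
    ; distinct = Unique-resp-↭ cs↭ds (HamCycleOn.distinct C)
    ; adjacent = adjacent
    ; closes   = closes
    ; sound    = λ x x∈ds → HamCycleOn.sound C x (∈-resp-↭ (↭-sym cs↭ds) x∈ds)
    ; complete = λ x kx → ∈-resp-↭ cs↭ds (HamCycleOn.complete C x kx)
    }

  HamCycleOn-resp-≐ : ∀ {Keep Keep′ : Fin n → Set} {cs} → Keep ≐ Keep′ →
                      HamCycleOn G Keep cs → HamCycleOn G Keep′ cs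
  HamCycleOn-resp-≐ (⊆ , ⊇) C = record
    { long     = HamCycleOn.long C
    ; distinct = HamCycleOn.distinct C
    ; adjacent = HamCycleOn.adjacent C
    ; closes   = HamCycleOn.closes C
    ; sound    = λ x x∈cs → ⊆ (HamCycleOn.sound C x x∈cs)
    ; complete = λ x kx → HamCycleOn.complete C x (⊇ kx)
    }

  rotate₁ : ∀ {Keep x ys} → HamCycleOn G Keep (x ∷ ys) → HamCycleOn G Keep (ys ∷ʳ x)
  rotate₁ {ys = []} C with HamCycleOn.long C
  ... | s≤s ()
  rotate₁ {x = x} {ys = y ∷ zs} C = HamCycleOn-resp-↭ (∷↭∷ʳ x (y ∷ zs)) adjacent
    (closes-∷ʳ y zs x (Linked.head (HamCycleOn.adjacent C))) C
    where
    adjacent : Linked (Adj G) (y ∷ zs ∷ʳ x)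
    adjacent = ++⁺ (Linked.tail (HamCycleOn.adjacent C))
                   (closes⇒connected x (y ∷ zs) (HamCycleOn.closes C)) [-]

  rotate : ∀ {Keep} xs ys → HamCycleOn G Keep (xs ++ ys) → HamCycleOn G Keep (ys ++ xs)
  rotate []       ys C = subst (HamCycleOn G _) (≡-sym (++-identityʳ ys)) C
  rotate (x ∷ xs) ys C = subst (HamCycleOn G _) (++-assoc ys [ x ] xs)
    (rotate xs (ys ∷ʳ x) (subst (HamCycleOn G _) (++-assoc xs ys [ x ]) (rotate₁ C)))

  splice : ∀ {Keep : Fin n → Set} {p q x y r} → ¬ Keep p → ¬ Keep q →
           HamCycleOn G Keep (y ∷ r ∷ʳ x) → Adj G x p → Adj G p q → Adj G q y →
           HamCycleOn G (λ z → z ≡ p ⊎ z ≡ q ⊎ Keep z) (p ∷ q ∷ y ∷ r ∷ʳ x)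
  splice {Keep} {p} {q} {x} {y} {r} ¬Kp ¬Kq C xp pq qy = record
    { long     = s≤s (s≤s (s≤s z≤n))
    ; distinct = (Adj⇒≢ pq ∷ outside ¬Kp) ∷ outside ¬Kq ∷ HamCycleOn.distinct C
    ; adjacent = pq ∷ qy ∷ HamCycleOn.adjacent C
    ; closes   = closes-∷ʳ p (q ∷ y ∷ r) x xp
    ; sound    = sound
    ; complete = complete
    }
    where
    outside : ∀ {z} → ¬ Keep z → All (λ c → ¬ z ≡ c) (y ∷ r ∷ʳ x)
    outside ¬Kz = All.tabulate λ c∈C → λ { refl → ¬Kz (HamCycleOn.sound C _ c∈C) }
    sound : ∀ z → z ∈ p ∷ q ∷ y ∷ r ∷ʳ x → z ≡ p ⊎ z ≡ q ⊎ Keep z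
    sound z (here z≡p)           = inj₁ z≡p
    sound z (there (here z≡q))   = inj₂ (inj₁ z≡q)
    sound z (there (there z∈C))  = inj₂ (inj₂ (HamCycleOn.sound C z z∈C))
    complete : ∀ z → z ≡ p ⊎ z ≡ q ⊎ Keep z → z ∈ p ∷ q ∷ y ∷ r ∷ʳ x
    complete z (inj₁ z≡p)        = here z≡p
    complete z (inj₂ (inj₁ z≡q)) = there (here z≡q)
    complete z (inj₂ (inj₂ kz))  = there (there (HamCycleOn.complete C z kz))

  splice-avoiding : ∀ {p q x y r} → HamCycleOn G (Avoiding p q) (y ∷ r ∷ʳ x) →
                    Adj G x p → Adj G p q → Adj G q y → Hamiltonian G
  splice-avoiding {p} {q} C xp pq qy =
    _ , HamCycleOn-resp-≐ ((λ _ → tt) , λ {z} _ → covered z)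
                          (splice (λ k → proj₁ k refl) (λ k → proj₂ k refl) C xp pq qy)
    where
    covered : ∀ z → z ≡ p ⊎ z ≡ q ⊎ Avoiding p q z
    covered z with z ≟ p | z ≟ q
    ... | yes z≡p | _       = inj₁ z≡p
    ... | no _    | yes z≡q = inj₂ (inj₁ z≡q)
    ... | no z≢p  | no z≢q  = inj₂ (inj₂ (z≢p , z≢q))

  cycle-from : ∀ {Keep u} rs → HamCycleOn G Keep (u ∷ rs) →
               Σ (Fin n) λ a → Σ (List (Fin n)) λ mid → Σ (Fin n) λ b →
                 HamCycleOn G Keep (u ∷ a ∷ mid ∷ʳ b)
  cycle-from rs C with initLast rs | HamCycleOn.long C
  ... | []              | s≤s ()
  ... | [] ∷ʳ′ _        | s≤s (s≤s ())
  ... | (a ∷ mid) ∷ʳ′ b | _ = a , mid , b , C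

  cycle-through : ∀ {Keep cs u} → HamCycleOn G Keep cs → Keep u →
                  Σ (Fin n) λ a → Σ (List (Fin n)) λ mid → Σ (Fin n) λ b →
                    HamCycleOn G Keep (u ∷ a ∷ mid ∷ʳ b)
  cycle-through {u = u} C ku with ∈-∃++ (HamCycleOn.complete C u ku)
  ... | pre , post , refl = cycle-from (post ++ pre) (rotate pre (u ∷ post) C)

  successor≢predecessor : ∀ {Keep u a mid b} → HamCycleOn G Keep (u ∷ a ∷ mid ∷ʳ b) → ¬ a ≡ b
  successor≢predecessor {mid = mid} C refl with HamCycleOn.distinct C
  ... | _ ∷ a∉ ∷ _ = All.lookup a∉ (∈-++⁺ʳ mid (here refl)) refl

  ∉ClosedNbhd : ∀ {x z} → ¬ z ≡ x → ¬ Adj G x z → ¬ InClosedNbhd G x z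
  ∉ClosedNbhd z≢x _   (inj₁ z≡x) = z≢x z≡x
  ∉ClosedNbhd _   ¬xz (inj₂ xz)  = ¬xz xz

lemma5 : ∀ {n} (G : Graph n) → Connected G → K2-Hypohamiltonian G →
    (u v w : Fin n) → Adj G u v → Adj G v w → Adj G u w →
    Σ (Fin n) λ a → Σ (Fin n) λ b → ¬ a ≡ b ×
    Adj G u a × ¬ InClosedNbhd G v a × ¬ InClosedNbhd G w a ×
    Adj G u b × ¬ InClosedNbhd G v b × ¬ InClosedNbhd G w b
lemma5 G _ (K2-ham , non-ham) u v w uv vw uw
  with cycle-through G (proj₂ (K2-ham v w vw)) (Adj⇒≢ G uv , Adj⇒≢ G uw)
... | a , mid , b , C =
  a , b , successor≢predecessor G C ,
  ua , ∉ClosedNbhd G (proj₁ Ka) ¬va , ∉ClosedNbhd G (proj₂ Ka) ¬wa ,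
  ub , ∉ClosedNbhd G (proj₁ Kb) ¬vb , ∉ClosedNbhd G (proj₂ Kb) ¬wb
  where
  open HamCycleOn C
  ua : Adj G u a
  ua = Linked.head adjacent
  ub : Adj G u b
  ub = sym G (closing-edge G u (a ∷ mid) b closes)
  Ka : Avoiding G v w a
  Ka = sound a (there (here refl))
  Kb : Avoiding G v w b
  Kb = sound b (there (there (∈-++⁺ʳ mid (here refl))))
  C↻ : HamCycleOn G (Avoiding G v w) (a ∷ (mid ∷ʳ b) ∷ʳ u)
  C↻ = rotate G [ u ] (a ∷ mid ∷ʳ b) C
  flip : ∀ {cs} → HamCycleOn G (Avoiding G v w) cs → HamCycleOn G (Avoiding G w v) cs
  flip = HamCycleOn-resp-≐ G (swap , swap)
  ¬va : ¬ Adj G v a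
  ¬va va = non-ham (splice-avoiding G (flip C↻) uw (sym G vw) va)
  ¬wa : ¬ Adj G w a
  ¬wa wa = non-ham (splice-avoiding G C↻ uv vw wa)
  ¬vb : ¬ Adj G v b
  ¬vb vb = non-ham (splice-avoiding G {r = a ∷ mid} C (sym G vb) vw (sym G uw))
  ¬wb : ¬ Adj G w b
  ¬wb wb = non-ham (splice-avoiding G {r = a ∷ mid} (flip C) (sym G wb) (sym G vw) (sym G uv))
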